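{- Let $S\subset\mathbb{F}_q^k$ be an arc and $t=q+k-1-|S|$. Let $L$ be the matrix whose columns are indexed by $\binom{S}{k-2}$ and whose rows are indexed by ordered pairs $(A,A')$ with $A,A'\in\binom{S}{k-2}$, $A\cup A'\in\binom{S}{k-1}$ and $A<A'$ in lex order, with $((A,A'),A'')$-entry equal to $(-1)^{\tau(A,A\cup A')(t+1)}f_{A,S}(A'\setminus A)$ if $A''=A$, to $(-1)^{\tau(A',A\cup A')(t+1)+1}f_{A',S}(A\setminus A')$ if $A''=A'$, and $0$ otherwise. If there is a vector in the nullspace of $L$ all of whose coordinates are nonzero, then there exist invertible diagonal matrices $E_1,E_2$ such that $E_1Q_S^{\uparrow 0}E_2=I_S^{\uparrow 0}$, where $Q_S^{\uparrow 0}$ has rows indexed by $\binom{S}{k-1}$, columns indexed by $\binom{S}{k-2}$ and $(C,A)$-entry $f_{A,S}(C\setminus A)$ if $A\subset C$ and $0$ otherwise, and $I_S^{\uparrow 0}$ has the same indexing and $(C,A)$-entry $(-1)^{\tau(A,C)(t+1)}$ if $A\subset C$ and $0$ otherwise.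
   Context: $\mathbb{F}_q$ is a finite field of order $q$. An arc in $\mathbb{F}_q^k$ is an ordered family of at least $k$ vectors in which every subfamily of size $k$ is a basis; subsets inherit the order. $\binom{X}{m}$ is the set of $m$-subsets of $X$. For subsets of an ordered set, $A<A'$ in lex order if the smallest element of $A\triangle A'$ lies in $A$. Tangent function: for $A\in\binom{S}{k-2}$, let $H_A^1,\dots,H_A^m$ be all the $(k-1)$-dimensional subspaces of $\mathbb{F}_q^k$ meeting $S$ exactly in $A$, $\beta_A^i$ a linear functional with kernel $H_A^i$, and $f_{A,S}(x)=\prod_i\beta_A^i(x)$; $f_{A,S}(D)$ for a one-element set $D$ means $f_{A,S}$ at its element. For ordered subsets $A\subset C$ with $|C|=|A|+1$, $\tau(A,C)$ is the minimum number of transpositions needed to reorder the sequence (elements of $A$ in order, then the element of $C\setminus A$) into the order of $C$. -}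

module Defs where

open import Data.Bool using (Bool; true; false; if_then_else_; _∧_)
import Data.Bool as Bool
open import Data.Nat as ℕ using (ℕ; zero; suc; _∸_)
open import Data.Integer as ℤ using (ℤ; +_)
open import Data.Fin as Fin using (Fin)
open import Data.Fin.Subset as Sub using (Subset; ∣_∣; _∩_; _∪_; ∁; _∈_; _∉_; _⊆_)
open import Data.Fin.Subset.Properties using (_⊆?_)
open import Data.List as List using (List; []; _∷_; map; foldr; filterᵇ; concatMap; allFin; length)
open import Data.List.Relation.Unary.Unique.Propositional using (Unique)
import Data.List.Membership.Propositional as ListMem
open import Data.Vec as Vec using (Vec; []; _∷_; tabulate; zipWith)
open import Data.Vec.Properties using (≡-dec)
open import Data.Maybe using (Maybe; just; nothing; maybe)
open import Data.Product using (Σ; ∃; _×_; _,_)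
open import Relation.Nullary using (¬_; Dec; yes; no)
open import Relation.Nullary.Decidable using (⌊_⌋)
open import Relation.Binary.PropositionalEquality using (_≡_)
open import Relation.Binary.Definitions using (DecidableEquality)
open import Algebra.Structures using (IsCommutativeRing)

record FiniteField : Set₁ where
  field
    Carrier  : Set
    _≟_      : DecidableEquality Carrier
    _+_ _*_  : Carrier → Carrier → Carrier
    -_       : Carrier → Carrier
    0# 1#    : Carrier
    isCommutativeRing : IsCommutativeRing _≡_ _+_ _*_ -_ 0# 1#
    0≢1      : ¬ (0# ≡ 1#)
    inverse  : ∀ x → ¬ (x ≡ 0#) → ∃ λ y → x * y ≡ 1#
    elems          : List Carrier
    elems-unique   : Unique elems
    elems-complete : ∀ x → ListMem._∈_ x elems

  order : ℕ
  order = length elems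

_≟ˢ_ : ∀ {n} → DecidableEquality (Subset n)
_≟ˢ_ = ≡-dec Bool._≟_

allSubsets : (n : ℕ) → List (Subset n)
allSubsets zero    = [] ∷ []
allSubsets (suc n) = concatMap (λ b → map (b ∷_) (allSubsets n)) (true ∷ false ∷ [])

-- all m-subsets of Fin n, i.e. binom(S, m) with S indexed by Fin n
subsetsOfSize : (n m : ℕ) → List (Subset n)
subsetsOfSize n m = filterᵇ (λ A → ⌊ ∣ A ∣ ℕ.≟ m ⌋) (allSubsets n)

_∖_ : ∀ {n} → Subset n → Subset n → Subset n
A' ∖ A = A' ∩ ∁ A

-- the smallest element of a subset (if any); for a one-element set D
-- this is "its element"
firstElem : ∀ {n} → Subset n → Maybe (Fin n)
firstElem []            = nothing
firstElem (true  ∷ xs)  = just Fin.zero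
firstElem (false ∷ xs)  = Data.Maybe.map Fin.suc (firstElem xs)

lexLt : ∀ {n} → Subset n → Subset n → Bool
lexLt []           []            = false
lexLt (true  ∷ a)  (false ∷ b)   = true
lexLt (false ∷ a)  (true  ∷ b)   = false
lexLt (true  ∷ a)  (true  ∷ b)   = lexLt a b
lexLt (false ∷ a)  (false ∷ b)   = lexLt a b

-- τ(A, C) for A ⊂ C, |C| = |A| + 1: the minimum number of transpositions
-- turning (elements of A in order, x) into the order of C, where
-- {x} = C \ A.  Moving x from the end to its place is a cycle of length
-- 1 + #{a ∈ A : a > x}, so this number is #{a ∈ A : x < a}.
tau : ∀ {n} → Subset n → Subset n → ℕ
tau {n} A C = maybe (λ x → ∣ A ∩ tabulate (λ j → ⌊ x Fin.<? j ⌋) ∣) 0 (firstElem (C ∖ A))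

module _ (𝔽 : FiniteField) where
  open FiniteField 𝔽

  sumF : List Carrier → Carrier
  sumF = foldr _+_ 0#

  prodF : List Carrier → Carrier
  prodF = foldr _*_ 1#

  negOnePowℕ : ℕ → Carrier
  negOnePowℕ zero    = 1#
  negOnePowℕ (suc m) = - (negOnePowℕ m)

  negOnePow : ℤ → Carrier
  negOnePow z = negOnePowℕ ℤ.∣ z ∣

  zeroV : ∀ {k} → Vec Carrier k
  zeroV = Vec.replicate _ 0#

  _+V_ : ∀ {k} → Vec Carrier k → Vec Carrier k → Vec Carrier k
  _+V_ = zipWith _+_

  _·V_ : ∀ {k} → Carrier → Vec Carrier k → Vec Carrier k
  c ·V v = Vec.map (c *_) v

  dot : ∀ {k} → Vec Carrier k → Vec Carrier k → Carrier
  dot u x = Vec.foldr _ _+_ 0# (zipWith _*_ u x)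

  linComb : ∀ {k n} → (Fin n → Vec Carrier k) → (Fin n → Carrier) → Vec Carrier k
  linComb {n = n} S c = foldr _+V_ zeroV (map (λ i → c i ·V S i) (allFin n))

  IsBasis : ∀ {k n} → (Fin n → Vec Carrier k) → Subset n → Set
  IsBasis {k} {n} S T =
    (∀ (c : Fin n → Carrier) → (∀ i → i ∉ T → c i ≡ 0#) →
       linComb S c ≡ zeroV → ∀ i → i ∈ T → c i ≡ 0#)
    × (∀ (v : Vec Carrier k) → Σ (Fin n → Carrier) λ c →
         (∀ i → i ∉ T → c i ≡ 0#) × linComb S c ≡ v)

  IsArc : ∀ {k n} → (Fin n → Vec Carrier k) → Set
  IsArc {k} {n} S = (k ℕ.≤ n) × (∀ (T : Subset n) → ∣ T ∣ ≡ k → IsBasis S T)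

  allVecs : (k : ℕ) → List (Vec Carrier k)
  allVecs zero    = [] ∷ []
  allVecs (suc k) = concatMap (λ x → map (x ∷_) (allVecs k)) elems

  isZero : Carrier → Bool
  isZero x = ⌊ x ≟ 0# ⌋

  normalised : ∀ {k} → Vec Carrier k → Bool
  normalised []       = false
  normalised (x ∷ xs) = if isZero x then normalised xs else ⌊ x ≟ 1# ⌋

  -- the (k-1)-dimensional subspaces of F_q^k, each represented by the
  -- unique normalised coefficient vector u with H = ker (dot u)
  hyperplanes : (k : ℕ) → List (Vec Carrier k)
  hyperplanes k = filterᵇ normalised (allVecs k)

  meetPattern : ∀ {k n} → (Fin n → Vec Carrier k) → Vec Carrier k → Subset n
  meetPattern S u = tabulate (λ i → isZero (dot u (S i)))

  -- The functional β with kernel H (chosen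
  -- for A) is  x ↦ c A u * dot u x  with u the normalised vector of H and
  -- c A u ≠ 0 an arbitrary scalar; this ranges over all admissible choices.
  tangent : ∀ {k n} → (Fin n → Vec Carrier k) → (Subset n → Vec Carrier k → Carrier)
          → Subset n → Vec Carrier k → Carrier
  tangent {k} S c A x =
    prodF (map (λ u → c A u * dot u x)
               (filterᵇ (λ u → ⌊ meetPattern S u ≟ˢ A ⌋) (hyperplanes k)))

  tangentAt : ∀ {k n} → (Fin n → Vec Carrier k) → (Subset n → Vec Carrier k → Carrier)
            → Subset n → Subset n → Carrier
  tangentAt S c A D = maybe (λ x → tangent S c A (S x)) 0# (firstElem D)

  tParam : (k n : ℕ) → ℤ
  tParam k n = ((+ order) ℤ.+ (+ k)) ℤ.- (+ 1) ℤ.- (+ n)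

  Lentry : ∀ {k n} → (Fin n → Vec Carrier k) → (Subset n → Vec Carrier k → Carrier)
         → Subset n → Subset n → Subset n → Carrier
  Lentry {k} {n} S c A A' A'' =
    if ⌊ A'' ≟ˢ A ⌋
      then negOnePow ((+ tau A (A ∪ A')) ℤ.* (tParam k n ℤ.+ + 1))
             * tangentAt S c A (A' ∖ A)
      else (if ⌊ A'' ≟ˢ A' ⌋
              then negOnePow ((+ tau A' (A ∪ A')) ℤ.* (tParam k n ℤ.+ + 1) ℤ.+ + 1)
                     * tangentAt S c A' (A ∖ A')
              else 0#)

  NowhereZeroNullVector : ∀ {k n} → (Fin n → Vec Carrier k)
                        → (Subset n → Vec Carrier k → Carrier) → (Subset n → Carrier) → Set
  NowhereZeroNullVector {k} {n} S c v =
    (∀ A → ∣ A ∣ ≡ k ∸ 2 → ¬ (v A ≡ 0#))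
    × (∀ A A' → ∣ A ∣ ≡ k ∸ 2 → ∣ A' ∣ ≡ k ∸ 2 → ∣ A ∪ A' ∣ ≡ k ∸ 1 →
         lexLt A A' ≡ true →
         sumF (map (λ A'' → Lentry S c A A' A'' * v A'') (subsetsOfSize n (k ∸ 2))) ≡ 0#)

  Qentry : ∀ {k n} → (Fin n → Vec Carrier k) → (Subset n → Vec Carrier k → Carrier)
         → Subset n → Subset n → Carrier
  Qentry S c C A = if ⌊ A ⊆? C ⌋ then tangentAt S c A (C ∖ A) else 0#

  Ientry : (k n : ℕ) → Subset n → Subset n → Carrier
  Ientry k n C A =
    if ⌊ A ⊆? C ⌋ then negOnePow ((+ tau A C) ℤ.* (tParam k n ℤ.+ + 1)) else 0#

module Submission where

-- Write σ(A,C) = (-1)^{τ(A,C)(t+1)} and, for A ⊂ C with |C| = |A| + 1,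
--   G(A,C) = σ(A,C) · f_{A,S}(C ∖ A) · v(A).
-- The row (A,A') of L has exactly two nonzero entries, so L v = 0 says
-- precisely G(A, A∪A') = G(A', A∪A') (the extra sign in the A'-entry turns
-- the sum into a difference).  Two distinct (k-2)-subsets of a (k-1)-set C
-- have union C, and one of them is lex-smaller, so G(·,C) is constant on the
-- (k-2)-subsets of C; it is nonzero since signs square to 1, tangent values
-- at points of S outside A are nonzero, and v is nowhere zero.  Taking
-- e₂ = v and e₁(C) = G(A₀,C)⁻¹ for one fixed (k-2)-subset A₀ ⊂ C gives
--   e₁(C) · f_{A,S}(C ∖ A) · v(A) = σ(A,C)⁻¹ = σ(A,C).

open import Defs
open import Data.Bool using (Bool; true; false; if_then_else_; T)
open import Data.Bool.Properties using (T-≡)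
open import Data.Nat as ℕ using (ℕ; zero; suc; _∸_; _≤_; s≤s; z≤n)
import Data.Nat.Properties as ℕP
open import Data.Integer as ℤ using (ℤ; -[1+_])
open import Data.Fin using (Fin)
open import Data.Fin.Subset using (Subset; ∣_∣; _∩_; _∪_; ∁; _∈_; _∉_; _⊆_) renaming (⊥ to ∅)
open import Data.Fin.Subset.Properties
  using (drop-∷-⊆; out⊆; ⊆-refl; p⊆q⇒∣p∣≤∣q∣; p⊆p∪q; q⊆p∪q; x∈p∪q⁻;
         x∈p∩q⁺; x∈p∩q⁻; x∈∁p⇒x∉p; x∉p⇒x∈∁p; _∈?_; _⊆?_;
         ∪-comm; ∪-identityˡ; ∩-distribʳ-∪; ∩-inverseʳ)
open import Data.List using (List; []; _∷_; map; filterᵇ; _++_)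
open import Data.Vec using (Vec; []; _∷_; here; there; tail)
open import Data.Vec.Properties using (lookup⇒[]=; lookup∘tabulate)
open import Data.Maybe using (just; nothing)
open import Data.Product using (Σ; _×_; _,_; proj₁; proj₂)
open import Data.Sum using (_⊎_; inj₁; inj₂; [_,_])
open import Data.Empty using (⊥-elim)
open import Function using (_∘_; Equivalence)
open import Relation.Nullary using (¬_; Dec; yes; no)
open import Relation.Nullary.Decidable using (⌊_⌋; toWitness)
open import Relation.Binary.PropositionalEquality using (_≡_; refl; sym; trans; cong; cong₂; subst; module ≡-Reasoning)
open import Algebra.Bundles using (CommutativeRing)
import Algebra.Properties.Ring as RingProperties

isYes-true : ∀ {P : Set} (d : Dec P) → P → ⌊ d ⌋ ≡ true
isYes-true (yes _) _ = refl
isYes-true (no ¬p) p = ⊥-elim (¬p p)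

isYes-false : ∀ {P : Set} (d : Dec P) → ¬ P → ⌊ d ⌋ ≡ false
isYes-false (yes p) ¬p = ⊥-elim (¬p p)
isYes-false (no _)  _  = refl

if-yes : ∀ {a} {A : Set a} {P : Set} (d : Dec P) {x y : A} → P → (if ⌊ d ⌋ then x else y) ≡ x
if-yes d p = cong (if_then _ else _) (isYes-true d p)

if-no : ∀ {a} {A : Set a} {P : Set} (d : Dec P) {x y : A} → ¬ P → (if ⌊ d ⌋ then x else y) ≡ y
if-no d ¬p = cong (if_then _ else _) (isYes-false d ¬p)

⊆-card-≡ : ∀ {n} (A C : Subset n) → A ⊆ C → ∣ A ∣ ≡ ∣ C ∣ → A ≡ C
⊆-card-≡ []          []          _ _ = refl
⊆-card-≡ (true ∷ A)  (false ∷ C) s _ with s here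
... | ()
⊆-card-≡ (true ∷ A)  (true ∷ C)  s e = cong (true ∷_) (⊆-card-≡ A C (drop-∷-⊆ s) (ℕP.suc-injective e))
⊆-card-≡ (false ∷ A) (false ∷ C) s e = cong (false ∷_) (⊆-card-≡ A C (drop-∷-⊆ s) e)
⊆-card-≡ (false ∷ A) (true ∷ C)  s e =
  ⊥-elim (ℕP.1+n≰n (subst (_≤ ∣ C ∣) e (p⊆q⇒∣p∣≤∣q∣ (drop-∷-⊆ s))))

∪-⊆ : ∀ {n} {A B C : Subset n} → A ⊆ C → B ⊆ C → A ∪ B ⊆ C
∪-⊆ {A = A} {B} A⊆C B⊆C = [ A⊆C , B⊆C ] ∘ x∈p∪q⁻ A B

squeezed : ∀ {m x} → m ≤ x → x ≤ suc m → x ≡ m ⊎ x ≡ suc m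
squeezed m≤x x≤1+m with ℕP.m≤n⇒m<n∨m≡n x≤1+m
... | inj₁ x<1+m = inj₁ (ℕP.≤-antisym (ℕP.m<1+n⇒m≤n x<1+m) m≤x)
... | inj₂ x≡1+m = inj₂ x≡1+m

-- Two distinct hyperfaces (subsets of codimension one) of C span C.  This
-- is why every pair of (k-2)-subsets of a (k-1)-set C indexes a row of L.
hyperfaces-∪ : ∀ {n} (A B C : Subset n) → A ⊆ C → B ⊆ C →
  suc ∣ A ∣ ≡ ∣ C ∣ → suc ∣ B ∣ ≡ ∣ C ∣ → ¬ A ≡ B → A ∪ B ≡ C
hyperfaces-∪ A B C A⊆C B⊆C ∣A∣ ∣B∣ A≢B
  with squeezed (p⊆q⇒∣p∣≤∣q∣ (p⊆p∪q {p = A} B))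
                (subst (∣ A ∪ B ∣ ≤_) (sym ∣A∣) (p⊆q⇒∣p∣≤∣q∣ (∪-⊆ A⊆C B⊆C)))
... | inj₂ full = ⊆-card-≡ (A ∪ B) C (∪-⊆ A⊆C B⊆C) (trans full ∣A∣)
... | inj₁ small = ⊥-elim (A≢B (trans A≡A∪B (sym B≡A∪B)))
  where
    A≡A∪B : A ≡ A ∪ B
    A≡A∪B = ⊆-card-≡ A (A ∪ B) (p⊆p∪q B) (sym small)
    B≡A∪B : B ≡ A ∪ B
    B≡A∪B = ⊆-card-≡ B (A ∪ B) (q⊆p∪q A B)
              (sym (trans small (ℕP.suc-injective (trans ∣A∣ (sym ∣B∣)))))

lexLt-total : ∀ {n} (A B : Subset n) → ¬ A ≡ B → lexLt A B ≡ true ⊎ lexLt B A ≡ true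
lexLt-total []          []          A≢B = ⊥-elim (A≢B refl)
lexLt-total (true ∷ A)  (false ∷ B) _   = inj₁ refl
lexLt-total (false ∷ A) (true ∷ B)  _   = inj₂ refl
lexLt-total (true ∷ A)  (true ∷ B)  A≢B = lexLt-total A B (A≢B ∘ cong (true ∷_))
lexLt-total (false ∷ A) (false ∷ B) A≢B = lexLt-total A B (A≢B ∘ cong (false ∷_))

∪-∖ˡ : ∀ {n} (A B : Subset n) → (A ∪ B) ∖ A ≡ B ∖ A
∪-∖ˡ A B = begin
  (A ∪ B) ∩ ∁ A             ≡⟨ ∩-distribʳ-∪ (∁ A) A B ⟩
  (A ∩ ∁ A) ∪ (B ∩ ∁ A)     ≡⟨ cong (_∪ (B ∩ ∁ A)) (∩-inverseʳ A) ⟩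
  ∅ ∪ (B ∩ ∁ A)             ≡⟨ ∪-identityˡ (B ∩ ∁ A) ⟩
  B ∩ ∁ A                   ∎
  where open ≡-Reasoning

∪-∖ʳ : ∀ {n} (A B : Subset n) → (A ∪ B) ∖ B ≡ A ∖ B
∪-∖ʳ A B = trans (cong (_∖ B) (∪-comm A B)) (∪-∖ˡ B A)

removeFirst : ∀ {n} → Subset n → Subset n
removeFirst []           = []
removeFirst (true ∷ xs)  = false ∷ xs
removeFirst (false ∷ xs) = false ∷ removeFirst xs

removeFirst-⊆ : ∀ {n} (C : Subset n) → removeFirst C ⊆ C
removeFirst-⊆ []           ()
removeFirst-⊆ (true ∷ xs)  = out⊆ ⊆-refl
removeFirst-⊆ (false ∷ xs) = out⊆ (removeFirst-⊆ xs)

removeFirst-card : ∀ {n m} (C : Subset n) → ∣ C ∣ ≡ suc m → ∣ removeFirst C ∣ ≡ m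
removeFirst-card (true ∷ xs)  e = ℕP.suc-injective e
removeFirst-card (false ∷ xs) e = removeFirst-card xs e

firstElem-just : ∀ {n} (D : Subset n) {x} → firstElem D ≡ just x → x ∈ D
firstElem-just (true ∷ D) refl = here
firstElem-just (false ∷ D) e with firstElem D in e'
firstElem-just (false ∷ D) refl | just y = there (firstElem-just D e')

firstElem-nothing : ∀ {n} (D : Subset n) {x} → firstElem D ≡ nothing → x ∉ D
firstElem-nothing (false ∷ D) e (there p) with firstElem D in e'
firstElem-nothing (false ∷ D) refl (there p) | nothing = firstElem-nothing D e' p

module FieldFacts (𝔽 : FiniteField) where
  open FiniteField 𝔽

  ring : CommutativeRing _ _
  ring = record { isCommutativeRing = isCommutativeRing }

  open CommutativeRing ring public
    using (+-assoc; +-comm; +-identityˡ; +-identityʳ; *-assoc; *-comm;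
           *-identityˡ; *-identityʳ; zeroˡ; zeroʳ)
  open RingProperties (CommutativeRing.ring ring) public
    using (-‿distribˡ-*; -‿involutive; x∙y⁻¹≈ε⇒x≈y)

  nonzero-* : ∀ {a b} → ¬ a ≡ 0# → ¬ b ≡ 0# → ¬ (a * b ≡ 0#)
  nonzero-* {a} {b} a≢0 b≢0 ab≡0 with inverse a a≢0
  ... | a⁻¹ , aa⁻¹≡1 = b≢0 (begin
      b                ≡⟨ sym (*-identityˡ b) ⟩
      1# * b           ≡⟨ cong (_* b) (trans (sym aa⁻¹≡1) (*-comm a a⁻¹)) ⟩
      (a⁻¹ * a) * b    ≡⟨ *-assoc a⁻¹ a b ⟩
      a⁻¹ * (a * b)    ≡⟨ cong (a⁻¹ *_) ab≡0 ⟩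
      a⁻¹ * 0#         ≡⟨ zeroʳ a⁻¹ ⟩
      0#               ∎)
    where open ≡-Reasoning

  -- The total reciprocal (0 ↦ 0), so it can be applied before knowing x ≢ 0.
  recip : Carrier → Carrier
  recip x with x ≟ 0#
  ... | yes _   = 0#
  ... | no x≢0  = proj₁ (inverse x x≢0)

  recip-inverse : ∀ x → ¬ x ≡ 0# → x * recip x ≡ 1#
  recip-inverse x x≢0 with x ≟ 0#
  ... | yes x≡0 = ⊥-elim (x≢0 x≡0)
  ... | no x≢0′ = proj₂ (inverse x x≢0′)

  recip-nonzero : ∀ x → ¬ x ≡ 0# → ¬ recip x ≡ 0#
  recip-nonzero x x≢0 r≡0 =
    0≢1 (trans (sym (zeroʳ x)) (trans (cong (x *_) (sym r≡0)) (recip-inverse x x≢0)))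

  -- If a² = 1 then (a·b·w)⁻¹·b·w = a: dividing by a unit sign multiplies by it.
  recip-sign : ∀ a b w → ¬ ((a * b) * w) ≡ 0# → a * a ≡ 1# → (recip ((a * b) * w) * b) * w ≡ a
  recip-sign a b w abw≢0 aa≡1 = begin
      (r * b) * w              ≡⟨ *-assoc r b w ⟩
      r * (b * w)              ≡⟨ *-comm r (b * w) ⟩
      (b * w) * r              ≡⟨ sym (*-identityˡ _) ⟩
      1# * ((b * w) * r)       ≡⟨ cong (_* ((b * w) * r)) (sym aa≡1) ⟩
      (a * a) * ((b * w) * r)  ≡⟨ *-assoc a a _ ⟩
      a * (a * ((b * w) * r))  ≡⟨ cong (a *_) (sym (*-assoc a (b * w) r)) ⟩
      a * ((a * (b * w)) * r)  ≡⟨ cong (λ z → a * (z * r)) (sym (*-assoc a b w)) ⟩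
      a * (((a * b) * w) * r)  ≡⟨ cong (a *_) (recip-inverse _ abw≢0) ⟩
      a * 1#                   ≡⟨ *-identityʳ a ⟩
      a                        ∎
    where open ≡-Reasoning
          r : Carrier
          r = recip ((a * b) * w)

  sign-square : ∀ m → negOnePowℕ 𝔽 m * negOnePowℕ 𝔽 m ≡ 1#
  sign-square zero    = *-identityˡ 1#
  sign-square (suc m) = begin
      (- σ) * (- σ)      ≡⟨ sym (-‿distribˡ-* σ (- σ)) ⟩
      - (σ * (- σ))      ≡⟨ cong -_ (*-comm σ (- σ)) ⟩
      - ((- σ) * σ)      ≡⟨ cong -_ (sym (-‿distribˡ-* σ σ)) ⟩
      - (- (σ * σ))      ≡⟨ -‿involutive (σ * σ) ⟩
      σ * σ              ≡⟨ sign-square m ⟩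
      1#                 ∎
    where open ≡-Reasoning
          σ = negOnePowℕ 𝔽 m

  sign-nonzero : ∀ z → ¬ negOnePow 𝔽 z ≡ 0#
  sign-nonzero z σ≡0 =
    0≢1 (trans (sym (zeroˡ _)) (trans (cong (_* negOnePow 𝔽 z) (sym σ≡0)) (sign-square ℤ.∣ z ∣)))

  sign-suc : ∀ z → negOnePow 𝔽 (z ℤ.+ ℤ.+ 1) ≡ - negOnePow 𝔽 z
  sign-suc (ℤ.+ m)          = cong (negOnePowℕ 𝔽) (ℕP.+-comm m 1)
  sign-suc -[1+ zero ]      = sym (-‿involutive 1#)
  sign-suc -[1+ suc m ]     = sym (-‿involutive _)

  sumOver : ∀ {A : Set} → (A → Carrier) → List A → Carrier
  sumOver f xs = sumF 𝔽 (map f xs)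

  sumOver-cong : ∀ {A : Set} {f g : A → Carrier} → (∀ x → f x ≡ g x) → ∀ xs → sumOver f xs ≡ sumOver g xs
  sumOver-cong f≗g []       = refl
  sumOver-cong f≗g (x ∷ xs) = cong₂ _+_ (f≗g x) (sumOver-cong f≗g xs)

  sumOver-zero : ∀ {A : Set} {f : A → Carrier} → (∀ x → f x ≡ 0#) → ∀ xs → sumOver f xs ≡ 0#
  sumOver-zero f≗0 []       = refl
  sumOver-zero f≗0 (x ∷ xs) = trans (cong₂ _+_ (f≗0 x) (sumOver-zero f≗0 xs)) (+-identityˡ 0#)

  sumOver-+ : ∀ {A : Set} (f g : A → Carrier) xs →
    sumOver (λ x → f x + g x) xs ≡ sumOver f xs + sumOver g xs
  sumOver-+ f g []       = sym (+-identityˡ 0#)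
  sumOver-+ f g (x ∷ xs) = begin
      (f x + g x) + sumOver (λ y → f y + g y) xs    ≡⟨ cong ((f x + g x) +_) (sumOver-+ f g xs) ⟩
      (f x + g x) + (F + G)                          ≡⟨ +-assoc (f x) (g x) (F + G) ⟩
      f x + (g x + (F + G))                          ≡⟨ cong (f x +_) (sym (+-assoc (g x) F G)) ⟩
      f x + ((g x + F) + G)                          ≡⟨ cong (λ z → f x + (z + G)) (+-comm (g x) F) ⟩
      f x + ((F + g x) + G)                          ≡⟨ cong (f x +_) (+-assoc F (g x) G) ⟩
      f x + (F + (g x + G))                          ≡⟨ sym (+-assoc (f x) F (g x + G)) ⟩
      (f x + F) + (g x + G)                          ∎
    where open ≡-Reasoning
          F G : Carrier
          F = sumOver f xs
          G = sumOver g xs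

  sumOver-++ : ∀ {A : Set} (f : A → Carrier) xs ys → sumOver f (xs ++ ys) ≡ sumOver f xs + sumOver f ys
  sumOver-++ f []       ys = sym (+-identityˡ _)
  sumOver-++ f (x ∷ xs) ys = trans (cong (f x +_) (sumOver-++ f xs ys)) (sym (+-assoc _ _ _))

  sumOver-map : ∀ {A B : Set} (f : B → Carrier) (h : A → B) xs → sumOver f (map h xs) ≡ sumOver (f ∘ h) xs
  sumOver-map f h []       = refl
  sumOver-map f h (x ∷ xs) = cong (f (h x) +_) (sumOver-map f h xs)

  sumOver-filter : ∀ {A : Set} (p : A → Bool) (h : A → Carrier) xs →
    sumOver h (filterᵇ p xs) ≡ sumOver (λ x → if p x then h x else 0#) xs
  sumOver-filter p h []       = refl
  sumOver-filter p h (x ∷ xs) with p x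
  ... | true  = cong (h x +_) (sumOver-filter p h xs)
  ... | false = trans (sumOver-filter p h xs) (sym (+-identityˡ _))

  sumOver-allSubsets-suc : ∀ {n} (g : Subset (suc n) → Carrier) →
    sumOver g (allSubsets (suc n))
      ≡ sumOver (g ∘ (true ∷_)) (allSubsets n) + sumOver (g ∘ (false ∷_)) (allSubsets n)
  sumOver-allSubsets-suc {n} g = begin
      sumOver g (map (true ∷_) X ++ (map (false ∷_) X ++ []))
        ≡⟨ sumOver-++ g (map (true ∷_) X) _ ⟩
      sumOver g (map (true ∷_) X) + sumOver g (map (false ∷_) X ++ [])
        ≡⟨ cong (sumOver g (map (true ∷_) X) +_) (trans (sumOver-++ g (map (false ∷_) X) []) (+-identityʳ _)) ⟩
      sumOver g (map (true ∷_) X) + sumOver g (map (false ∷_) X)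
        ≡⟨ cong₂ _+_ (sumOver-map g (true ∷_) X) (sumOver-map g (false ∷_) X) ⟩
      sumOver (g ∘ (true ∷_)) X + sumOver (g ∘ (false ∷_)) X ∎
    where open ≡-Reasoning
          X : List (Subset n)
          X = allSubsets n

  sumOver-point : ∀ n (g : Subset n → Carrier) (A : Subset n) →
    (∀ X → ¬ X ≡ A → g X ≡ 0#) → sumOver g (allSubsets n) ≡ g A
  sumOver-point zero    g []         g≗0 = +-identityʳ (g [])
  sumOver-point (suc n) g (true ∷ A) g≗0 = begin
      sumOver g (allSubsets (suc n))                ≡⟨ sumOver-allSubsets-suc g ⟩
      sumOver (g ∘ (true ∷_)) (allSubsets n) + sumOver (g ∘ (false ∷_)) (allSubsets n)
        ≡⟨ cong₂ _+_ (sumOver-point n (g ∘ (true ∷_)) A (λ X X≢A → g≗0 (true ∷ X) (X≢A ∘ cong tail)))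
                     (sumOver-zero (λ X → g≗0 (false ∷ X) (λ ())) (allSubsets n)) ⟩
      g (true ∷ A) + 0#                             ≡⟨ +-identityʳ _ ⟩
      g (true ∷ A)                                  ∎
    where open ≡-Reasoning
  sumOver-point (suc n) g (false ∷ A) g≗0 = begin
      sumOver g (allSubsets (suc n))                ≡⟨ sumOver-allSubsets-suc g ⟩
      sumOver (g ∘ (true ∷_)) (allSubsets n) + sumOver (g ∘ (false ∷_)) (allSubsets n)
        ≡⟨ cong₂ _+_ (sumOver-zero (λ X → g≗0 (true ∷ X) (λ ())) (allSubsets n))
                     (sumOver-point n (g ∘ (false ∷_)) A (λ X X≢A → g≗0 (false ∷ X) (X≢A ∘ cong tail))) ⟩
      0# + g (false ∷ A)                            ≡⟨ +-identityˡ _ ⟩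
      g (false ∷ A)                                 ∎
    where open ≡-Reasoning

  sumOver-pair : ∀ n (g : Subset n → Carrier) (A B : Subset n) → ¬ A ≡ B →
    (∀ X → ¬ X ≡ A → ¬ X ≡ B → g X ≡ 0#) → sumOver g (allSubsets n) ≡ g A + g B
  sumOver-pair n g A B A≢B g≗0 = begin
      sumOver g (allSubsets n)
        ≡⟨ sumOver-cong split (allSubsets n) ⟩
      sumOver (λ X → g-at A X + g-at B X) (allSubsets n)
        ≡⟨ sumOver-+ (g-at A) (g-at B) (allSubsets n) ⟩
      sumOver (g-at A) (allSubsets n) + sumOver (g-at B) (allSubsets n)
        ≡⟨ cong₂ _+_ (sumOver-point n (g-at A) A (g-at-off A))
                     (sumOver-point n (g-at B) B (g-at-off B)) ⟩
      g-at A A + g-at B B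
        ≡⟨ cong₂ _+_ (if-yes (A ≟ˢ A) refl) (if-yes (B ≟ˢ B) refl) ⟩
      g A + g B ∎
    where
      open ≡-Reasoning
      g-at : Subset n → Subset n → Carrier
      g-at P X = if ⌊ X ≟ˢ P ⌋ then g X else 0#

      g-at-off : ∀ P X → ¬ X ≡ P → g-at P X ≡ 0#
      g-at-off P X = if-no (X ≟ˢ P)

      split : ∀ X → g X ≡ g-at A X + g-at B X
      split X with X ≟ˢ A | X ≟ˢ B
      ... | yes X≡A | yes X≡B = ⊥-elim (A≢B (trans (sym X≡A) X≡B))
      ... | yes _   | no _    = sym (+-identityʳ _)
      ... | no _    | yes _   = sym (+-identityˡ _)
      ... | no X≢A  | no X≢B  = trans (g≗0 X X≢A X≢B) (sym (+-identityˡ 0#))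

  sumOver-level-pair : ∀ n m (h : Subset n → Carrier) (A B : Subset n) →
    ∣ A ∣ ≡ m → ∣ B ∣ ≡ m → ¬ A ≡ B →
    (∀ X → ∣ X ∣ ≡ m → ¬ X ≡ A → ¬ X ≡ B → h X ≡ 0#) →
    sumOver h (subsetsOfSize n m) ≡ h A + h B
  sumOver-level-pair n m h A B ∣A∣ ∣B∣ A≢B h≗0 = begin
      sumOver h (subsetsOfSize n m)         ≡⟨ sumOver-filter _ h (allSubsets n) ⟩
      sumOver h≤ (allSubsets n)              ≡⟨ sumOver-pair n h≤ A B A≢B h≤≗0 ⟩
      h≤ A + h≤ B
        ≡⟨ cong₂ _+_ (if-yes (∣ A ∣ ℕ.≟ m) ∣A∣) (if-yes (∣ B ∣ ℕ.≟ m) ∣B∣) ⟩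
      h A + h B                              ∎
    where
      open ≡-Reasoning
      h≤ : Subset n → Carrier
      h≤ X = if ⌊ ∣ X ∣ ℕ.≟ m ⌋ then h X else 0#

      h≤≗0 : ∀ X → ¬ X ≡ A → ¬ X ≡ B → h≤ X ≡ 0#
      h≤≗0 X X≢A X≢B with ∣ X ∣ ℕ.≟ m
      ... | yes ∣X∣ = h≗0 X ∣X∣ X≢A X≢B
      ... | no _    = refl

  prodF-nonzero : ∀ {V : Set} (P : V → Bool) (g : V → Carrier) xs →
    (∀ u → T (P u) → ¬ g u ≡ 0#) → ¬ prodF 𝔽 (map g (filterᵇ P xs)) ≡ 0#
  prodF-nonzero P g []       _   1≡0 = 0≢1 (sym 1≡0)
  prodF-nonzero P g (x ∷ xs) g≢0 with P x in Px
  ... | true  = nonzero-* (g≢0 x (Equivalence.from T-≡ Px)) (prodF-nonzero P g xs g≢0)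
  ... | false = prodF-nonzero P g xs g≢0

  -- Every hyperplane meeting S exactly in A misses the point S x, x ∉ A.
  tangent-nonzero : ∀ {k n} (S : Fin n → Vec Carrier k) c → (∀ A u → ¬ c A u ≡ 0#) →
    ∀ A x → x ∉ A → ¬ tangent 𝔽 S c A (S x) ≡ 0#
  tangent-nonzero {k} S c c≢0 A x x∉A =
    prodF-nonzero _ _ (hyperplanes 𝔽 k) λ u meets → nonzero-* (c≢0 A u) λ βx≡0 →
      x∉A (subst (x ∈_) (toWitness meets) (x∈pattern u βx≡0))
    where
      x∈pattern : ∀ u → dot 𝔽 u (S x) ≡ 0# → x ∈ meetPattern 𝔽 S u
      x∈pattern u βx≡0 = lookup⇒[]= x _ (trans (lookup∘tabulate _ x) (isYes-true (dot 𝔽 u (S x) ≟ 0#) βx≡0))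

  tangentAt-nonzero : ∀ {k n} (S : Fin n → Vec Carrier k) c → (∀ A u → ¬ c A u ≡ 0#) →
    ∀ A C → A ⊆ C → suc ∣ A ∣ ≡ ∣ C ∣ → ¬ tangentAt 𝔽 S c A (C ∖ A) ≡ 0#
  tangentAt-nonzero S c c≢0 A C A⊆C ∣C∣ with firstElem (C ∖ A) in first
  ... | just x  = tangent-nonzero S c c≢0 A x
                    (x∈∁p⇒x∉p (proj₂ (x∈p∩q⁻ C (∁ A) (firstElem-just (C ∖ A) first))))
  ... | nothing = λ _ → ℕP.1+n≰n (subst (_≤ ∣ A ∣) (sym ∣C∣) (p⊆q⇒∣p∣≤∣q∣ C⊆A))
    where
      C⊆A : C ⊆ A
      C⊆A {x} x∈C with x ∈? A
      ... | yes x∈A = x∈A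
      ... | no x∉A  = ⊥-elim (firstElem-nothing (C ∖ A) first (x∈p∩q⁺ (x∈C , x∉p⇒x∈∁p x∉A)))

module Rescaling (𝔽 : FiniteField) (k' n : ℕ)
  (S : Fin n → Vec (FiniteField.Carrier 𝔽) (suc (suc k')))
  (c : Subset n → Vec (FiniteField.Carrier 𝔽) (suc (suc k')) → FiniteField.Carrier 𝔽)
  (c≢0 : ∀ A u → ¬ (c A u ≡ FiniteField.0# 𝔽))
  (v : Subset n → FiniteField.Carrier 𝔽) (null : NowhereZeroNullVector 𝔽 S c v) where
  open FiniteField 𝔽
  open FieldFacts 𝔽

  k : ℕ
  k = suc (suc k')

  exponent : Subset n → Subset n → ℤ
  exponent A C = ℤ.+ tau A C ℤ.* (tParam 𝔽 k n ℤ.+ ℤ.+ 1)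

  σ : Subset n → Subset n → Carrier
  σ A C = negOnePow 𝔽 (exponent A C)

  G : Subset n → Subset n → Carrier
  G A C = (σ A C * tangentAt 𝔽 S c A (C ∖ A)) * v A

  G-nonzero : ∀ A C → A ⊆ C → ∣ A ∣ ≡ k' → ∣ C ∣ ≡ suc k' → ¬ G A C ≡ 0#
  G-nonzero A C A⊆C ∣A∣ ∣C∣ =
    nonzero-* (nonzero-* (sign-nonzero (exponent A C))
                         (tangentAt-nonzero S c c≢0 A C A⊆C (trans (cong suc ∣A∣) (sym ∣C∣))))
              (proj₁ null A ∣A∣)

  row-balance : ∀ A B → ∣ A ∣ ≡ k' → ∣ B ∣ ≡ k' → ∣ A ∪ B ∣ ≡ suc k' → lexLt A B ≡ true → ¬ A ≡ B →
    G A (A ∪ B) ≡ G B (A ∪ B)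
  row-balance A B ∣A∣ ∣B∣ ∣A∪B∣ A<B A≢B = x∙y⁻¹≈ε⇒x≈y _ _ (begin
      G A (A ∪ B) + (- G B (A ∪ B))       ≡⟨ cong₂ _+_ (sym entry-A) (sym entry-B) ⟩
      (L A * v A) + (L B * v B)
        ≡⟨ sym (sumOver-level-pair n k' (λ X → L X * v X) A B ∣A∣ ∣B∣ A≢B L-off) ⟩
      sumOver (λ X → L X * v X) (subsetsOfSize n k')
                                          ≡⟨ proj₂ null A B ∣A∣ ∣B∣ ∣A∪B∣ A<B ⟩
      0#                                  ∎)
    where
      open ≡-Reasoning
      L : Subset n → Carrier
      L = Lentry 𝔽 S c A B

      L-off : ∀ X → ∣ X ∣ ≡ k' → ¬ X ≡ A → ¬ X ≡ B → L X * v X ≡ 0#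
      L-off X _ X≢A X≢B =
        trans (cong (_* v X) (trans (if-no (X ≟ˢ A) X≢A) (if-no (X ≟ˢ B) X≢B))) (zeroˡ _)

      entry-A : L A * v A ≡ G A (A ∪ B)
      entry-A = cong (_* v A) (trans (if-yes (A ≟ˢ A) refl)
                  (cong (λ D → σ A (A ∪ B) * tangentAt 𝔽 S c A D) (sym (∪-∖ˡ A B))))

      σB fB : Carrier
      σB = σ B (A ∪ B)
      fB = tangentAt 𝔽 S c B (A ∖ B)

      entry-B : L B * v B ≡ - G B (A ∪ B)
      entry-B = begin
        L B * v B
          ≡⟨ cong (_* v B) (trans (if-no (B ≟ˢ A) (A≢B ∘ sym)) (if-yes (B ≟ˢ B) refl)) ⟩
        (negOnePow 𝔽 (exponent B (A ∪ B) ℤ.+ ℤ.+ 1) * fB) * v B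
          ≡⟨ cong (λ w → (w * fB) * v B) (sign-suc (exponent B (A ∪ B))) ⟩
        ((- σB) * fB) * v B       ≡⟨ cong (_* v B) (sym (-‿distribˡ-* σB fB)) ⟩
        (- (σB * fB)) * v B       ≡⟨ sym (-‿distribˡ-* (σB * fB) (v B)) ⟩
        - ((σB * fB) * v B)
          ≡⟨ cong (λ D → - ((σB * tangentAt 𝔽 S c B D) * v B)) (sym (∪-∖ʳ A B)) ⟩
        - G B (A ∪ B)             ∎

  hyperface-balance : ∀ C X Y → ∣ C ∣ ≡ suc k' → X ⊆ C → Y ⊆ C → ∣ X ∣ ≡ k' → ∣ Y ∣ ≡ k' →
    lexLt X Y ≡ true → ¬ X ≡ Y → G X C ≡ G Y C
  hyperface-balance C X Y ∣C∣ X⊆C Y⊆C ∣X∣ ∣Y∣ X<Y X≢Y =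
    subst (λ D → G X D ≡ G Y D) X∪Y≡C (row-balance X Y ∣X∣ ∣Y∣ (trans (cong ∣_∣ X∪Y≡C) ∣C∣) X<Y X≢Y)
    where
      X∪Y≡C : X ∪ Y ≡ C
      X∪Y≡C = hyperfaces-∪ X Y C X⊆C Y⊆C
                (trans (cong suc ∣X∣) (sym ∣C∣)) (trans (cong suc ∣Y∣) (sym ∣C∣)) X≢Y

  G-constant : ∀ C A B → ∣ C ∣ ≡ suc k' → A ⊆ C → B ⊆ C → ∣ A ∣ ≡ k' → ∣ B ∣ ≡ k' →
    G A C ≡ G B C
  G-constant C A B ∣C∣ A⊆C B⊆C ∣A∣ ∣B∣ with A ≟ˢ B
  ... | yes refl = refl
  ... | no A≢B with lexLt-total A B A≢B
  ...   | inj₁ A<B = hyperface-balance C A B ∣C∣ A⊆C B⊆C ∣A∣ ∣B∣ A<B A≢B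
  ...   | inj₂ B<A = sym (hyperface-balance C B A ∣C∣ B⊆C A⊆C ∣B∣ ∣A∣ B<A (A≢B ∘ sym))

  e₁ : Subset n → Carrier
  e₁ C = recip (G (removeFirst C) C)

  e₁-nonzero : ∀ C → ∣ C ∣ ≡ suc k' → ¬ e₁ C ≡ 0#
  e₁-nonzero C ∣C∣ = recip-nonzero _ (G-nonzero _ C (removeFirst-⊆ C) (removeFirst-card C ∣C∣) ∣C∣)

  rescaled-entry : ∀ C A → ∣ C ∣ ≡ suc k' → ∣ A ∣ ≡ k' →
    (e₁ C * Qentry 𝔽 S c C A) * v A ≡ Ientry 𝔽 k n C A
  rescaled-entry C A ∣C∣ ∣A∣ with A ⊆? C
  ... | no _    = trans (cong (_* v A) (zeroʳ _)) (zeroˡ _)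
  ... | yes A⊆C =
    begin
      (recip (G A₀ C) * f) * v A
        ≡⟨ cong (λ g → (recip g * f) * v A)
                (G-constant C A₀ A ∣C∣ (removeFirst-⊆ C) A⊆C (removeFirst-card C ∣C∣) ∣A∣) ⟩
      (recip (G A C) * f) * v A
        ≡⟨ recip-sign (σ A C) f (v A) (G-nonzero A C A⊆C ∣A∣ ∣C∣) (sign-square ℤ.∣ exponent A C ∣) ⟩
      σ A C ∎
    where
      open ≡-Reasoning
      A₀ : Subset n
      A₀ = removeFirst C
      f : Carrier
      f = tangentAt 𝔽 S c A (C ∖ A)

-- Lemma 6.1.
lemma6p1 : (𝔽 : FiniteField) (k n : ℕ) → 2 ≤ k →
    (S : Fin n → Vec (FiniteField.Carrier 𝔽) k) → IsArc 𝔽 S →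
    (c : Subset n → Vec (FiniteField.Carrier 𝔽) k → FiniteField.Carrier 𝔽) →
    (∀ A u → ¬ (c A u ≡ FiniteField.0# 𝔽)) →
    Σ (Subset n → FiniteField.Carrier 𝔽) (NowhereZeroNullVector 𝔽 S c) →
    Σ (Subset n → FiniteField.Carrier 𝔽) λ e₁ →
    Σ (Subset n → FiniteField.Carrier 𝔽) λ e₂ →
      (∀ C → ∣ C ∣ ≡ k ∸ 1 → ¬ (e₁ C ≡ FiniteField.0# 𝔽))
      × (∀ A → ∣ A ∣ ≡ k ∸ 2 → ¬ (e₂ A ≡ FiniteField.0# 𝔽))
      × (∀ C A → ∣ C ∣ ≡ k ∸ 1 → ∣ A ∣ ≡ k ∸ 2 →
           FiniteField._*_ 𝔽 (FiniteField._*_ 𝔽 (e₁ C) (Qentry 𝔽 S c C A)) (e₂ A)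
             ≡ Ientry 𝔽 k n C A)
lemma6p1 𝔽 (suc (suc k')) n (s≤s (s≤s z≤n)) S _ c c≢0 (v , null) =
  e₁ , v , e₁-nonzero , proj₁ null , rescaled-entry
  where open Rescaling 𝔽 k' n S c c≢0 v null
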